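{- Every integral residuated lattice embeds (as a residuated lattice) into a nuclear image of some distributive integral cancellative residuated lattice which satisfies the equations $x(y\wedge z)=xy\wedge xz$ and $(x\wedge y)z=xz\wedge yz$.
   Context: A residuated lattice is an algebra $\langle L,\wedge,\vee,\cdot,1,\backslash,/\rangle$ where $\langle L,\wedge,\vee\rangle$ is a lattice, $\langle L,\cdot,1\rangle$ a monoid and $b\leq a\backslash c\iff ab\leq c\iff a\leq c/b$. It is integral if $1$ is the top element, cancellative if $ax\leq bx\Rightarrow a\leq b$ and $xa\leq xb\Rightarrow a\leq b$, distributive if its lattice reduct is distributive. A nucleus on $L$ is a monotone map $\gamma$ with $a\leq\gamma(a)=\gamma(\gamma(a))$ and $\gamma(a)\gamma(b)\leq\gamma(ab)$; the nuclear image $L_\gamma=\{a:\gamma(a)=a\}$ is the residuated lattice with meet $\wedge$, join $\gamma(a\vee b)$, multiplication $\gamma(ab)$, unit $\gamma(1)$ and the residuals of $L$. -}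

module Defs where

open import Level using (Level; _⊔_; suc)
open import Relation.Binary.Core using (Rel)
open import Algebra.Core using (Op₂)
open import Algebra.Structures using (IsMonoid)
open import Algebra.Lattice.Structures using (IsLattice)
open import Data.Product using (_×_; Σ)

record ResiduatedLattice (c ℓ : Level) : Set (suc (c ⊔ ℓ)) where
  infix  4 _≈_ _≤_
  infixr 6 _∨_
  infixr 7 _∧_
  infixl 8 _·_
  field
    Carrier   : Set c
    _≈_       : Rel Carrier ℓ
    _∧_       : Op₂ Carrier
    _∨_       : Op₂ Carrier
    _·_       : Op₂ Carrier
    one       : Carrier
    _\\_      : Op₂ Carrier
    _//_      : Op₂ Carrier
    isLattice : IsLattice _≈_ _∨_ _∧_
    isMonoid  : IsMonoid _≈_ _·_ one

  _≤_ : Rel Carrier ℓ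
  x ≤ y = (x ∧ y) ≈ x

  field
    resˡ-to   : ∀ {a b c} → b ≤ (a \\ c) → (a · b) ≤ c
    resˡ-from : ∀ {a b c} → (a · b) ≤ c → b ≤ (a \\ c)
    resʳ-to   : ∀ {a b c} → a ≤ (c // b) → (a · b) ≤ c
    resʳ-from : ∀ {a b c} → (a · b) ≤ c → a ≤ (c // b)

module _ {c ℓ : Level} (L : ResiduatedLattice c ℓ) where
  open ResiduatedLattice L

  IsIntegral : Set (c ⊔ ℓ)
  IsIntegral = ∀ x → x ≤ one

  IsCancellative : Set (c ⊔ ℓ)
  IsCancellative =
    (∀ {a b x} → (a · x) ≤ (b · x) → a ≤ b) ×
    (∀ {a b x} → (x · a) ≤ (x · b) → a ≤ b)

  IsDistributive : Set (c ⊔ ℓ)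
  IsDistributive = ∀ x y z → (x ∧ (y ∨ z)) ≈ ((x ∧ y) ∨ (x ∧ z))

  MultDistribOverMeet : Set (c ⊔ ℓ)
  MultDistribOverMeet =
    (∀ x y z → (x · (y ∧ z)) ≈ ((x · y) ∧ (x · z))) ×
    (∀ x y z → ((x ∧ y) · z) ≈ ((x · z) ∧ (y · z)))

  record IsNucleus (γ : Carrier → Carrier) : Set (c ⊔ ℓ) where
    field
      cong       : ∀ {a b} → a ≈ b → γ a ≈ γ b
      monotone   : ∀ {a b} → a ≤ b → γ a ≤ γ b
      extensive  : ∀ a → a ≤ γ a
      idempotent : ∀ a → γ (γ a) ≈ γ a
      mult       : ∀ a b → (γ a · γ b) ≤ γ (a · b)

module _ {c₁ ℓ₁ c₂ ℓ₂ : Level}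
         (L : ResiduatedLattice c₁ ℓ₁) (M : ResiduatedLattice c₂ ℓ₂) where
  private
    module L = ResiduatedLattice L
    module M = ResiduatedLattice M

  -- f is a residuated-lattice embedding of L into the nuclear image M_γ,
  -- whose operations are: meet ∧, join γ(a ∨ b), product γ(ab),
  -- unit γ(1), and the residuals \ , / of M.
  record IsEmbeddingIntoNuclearImage (γ : M.Carrier → M.Carrier)
                                     (f : L.Carrier → M.Carrier)
                                     : Set (c₁ ⊔ ℓ₁ ⊔ ℓ₂) where
    field
      cong      : ∀ {a b} → a L.≈ b → f a M.≈ f b
      injective : ∀ {a b} → f a M.≈ f b → a L.≈ b
      closed    : ∀ a → γ (f a) M.≈ f a
      pres-∧    : ∀ a b → f (a L.∧ b) M.≈ (f a M.∧ f b)
      pres-∨    : ∀ a b → f (a L.∨ b) M.≈ γ (f a M.∨ f b)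
      pres-·    : ∀ a b → f (a L.· b) M.≈ γ (f a M.· f b)
      pres-one  : f L.one M.≈ γ M.one
      pres-\\   : ∀ a b → f (a L.\\ b) M.≈ (f a M.\\ f b)
      pres-//   : ∀ a b → f (a L.// b) M.≈ (f a M.// f b)

{-# OPTIONS --safe #-}
module Submission where

-- Take M to be the nonempty up-sets of words over L in the subword order, ordered by
-- inclusion, with the complex product.  Two factorisations x y ⊆ w and x′ z ⊆ w cut w at
-- comparable positions, so the product distributes over meets; and a witness z of Z in
-- w z ∈ Y Z can always be traded for a strictly shorter one unless w ∈ Y, which gives
-- cancellativity.  Integrality makes the evaluation ∏ of words antitone in the subword
-- order, so a ↦ {w ∣ ∏ w ≤ a} maps L into M, and X ↦ {w ∣ ∏ w lies below every upper
-- bound of ∏[X]} is a nucleus whose image contains these principal sets and computes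
-- the operations of L on them.

open import Level using (Level; _⊔_; suc; Lift; lift; lower)
open import Function using (id; _∘_)
open import Data.Unit.Polymorphic using (⊤)
open import Data.Product using (Σ; ∃; _×_; _,_; proj₁; proj₂)
import Data.Product as Product
open import Data.Sum using (_⊎_; inj₁; inj₂; [_,_]′)
import Data.Sum as Sum
open import Data.Nat as ℕ using (zero; s≤s)
open import Data.Nat.Properties using (≤-total; ≤-trans)
open import Data.Nat.Induction using (<-wellFounded)
open import Induction.WellFounded using (Acc; acc)
open import Data.List using (List; []; _∷_; [_]; _++_; foldr; length; take; drop; reverse)
open import Data.List.Properties
  using (++-assoc; ++-identityʳ; take++drop≡id; reverse-++; length-reverse)
open import Data.List.Relation.Binary.Sublist.Propositional
  using (_⊆_; []; _∷_; _∷ʳ_; ⊆-refl; ⊆-trans; ⊆-reflexive; minimum)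
open import Data.List.Relation.Binary.Sublist.Propositional.Properties
  using (length-mono-≤; ++⁺; ++⁺ˡ; ++⁺ʳ; take⁺; drop⁺-≥; reverse⁺; reverse⁻)
open import Relation.Binary.Core using (Rel)
open import Relation.Binary.Structures using (IsEquivalence)
open import Relation.Binary.Bundles using (Poset)
open import Relation.Binary.PropositionalEquality as ≡ using (subst; subst₂)
import Relation.Binary.Lattice as Order
import Relation.Binary.Reasoning.PartialOrder as ≤-Reasoning
open import Algebra.Structures using (IsMonoid)
open import Algebra.Lattice.Structures using (IsLattice)
open import Algebra.Lattice.Bundles using (Lattice)
import Algebra.Lattice.Properties.Lattice as LatticeProperties
open import Defs

module _ {a} {A : Set a} where

  ++-⊆-split : ∀ u {v w : List A} → u ++ v ⊆ w → ∃ λ n → u ⊆ take n w × v ⊆ drop n w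
  ++-⊆-split []      v⊆w            = zero , [] , v⊆w
  ++-⊆-split (x ∷ u) (y ∷ʳ xuv⊆w)   with ++-⊆-split (x ∷ u) xuv⊆w
  ... | n , xu⊆w₁ , v⊆w₂ = ℕ.suc n , y ∷ʳ xu⊆w₁ , v⊆w₂
  ++-⊆-split (x ∷ u) (≡.refl ∷ uv⊆w) with ++-⊆-split u uv⊆w
  ... | n , u⊆w₁ , v⊆w₂ = ℕ.suc n , ≡.refl ∷ u⊆w₁ , v⊆w₂

  take++drop-⊆ : ∀ n {u v w : List A} → u ⊆ take n w → v ⊆ drop n w → u ++ v ⊆ w
  take++drop-⊆ n {w = w} u⊆w₁ v⊆w₂ = subst (_ ⊆_) (take++drop≡id n w) (++⁺ u⊆w₁ v⊆w₂)

  ++-⊆-++-cancelʳ⊎shorter : ∀ w {y z′ z : List A} → y ++ z′ ⊆ w ++ z →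
                            y ⊆ w ⊎ length z′ ℕ.< length z
  ++-⊆-++-cancelʳ⊎shorter w       {[]}    _              = inj₁ (minimum w)
  ++-⊆-++-cancelʳ⊎shorter []      {x ∷ y} xyz′⊆z =
    inj₂ (≤-trans (s≤s (length-mono-≤ (++⁺ˡ y ⊆-refl))) (length-mono-≤ xyz′⊆z))
  ++-⊆-++-cancelʳ⊎shorter (c ∷ w) {x ∷ y} (.c ∷ʳ p) =
    Sum.map₁ (c ∷ʳ_) (++-⊆-++-cancelʳ⊎shorter w p)
  ++-⊆-++-cancelʳ⊎shorter (c ∷ w) {x ∷ y} (≡.refl ∷ p) =
    Sum.map₁ (≡.refl ∷_) (++-⊆-++-cancelʳ⊎shorter w p)

  ++-⊆-++-cancelˡ⊎shorter : ∀ w {y z′ z : List A} → z′ ++ y ⊆ z ++ w →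
                            y ⊆ w ⊎ length z′ ℕ.< length z
  ++-⊆-++-cancelˡ⊎shorter w {y} {z′} {z} p =
    Sum.map reverse⁻ (subst₂ ℕ._<_ (length-reverse z′) (length-reverse z))
      (++-⊆-++-cancelʳ⊎shorter (reverse w)
        (subst₂ _⊆_ (reverse-++ z′ y) (reverse-++ z w) (reverse⁺ p)))

module ResiduatedLatticeOrder {c ℓ} (L : ResiduatedLattice c ℓ) where
  open ResiduatedLattice L

  private
    lattice : Lattice c ℓ
    lattice = record { isLattice = isLattice }
    module Std = Order.Lattice (LatticeProperties.∨-∧-orderTheoreticLattice lattice)
    open Lattice lattice using (sym)

  -- Here x ≤ y means x ∧ y ≈ x, whereas the library orders a lattice by x ≈ x ∧ y.
  ≤-isLattice : Order.IsLattice _≈_ _≤_ _∨_ _∧_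
  ≤-isLattice = record
    { isPartialOrder = record
      { isPreorder = record
        { isEquivalence = Std.isEquivalence
        ; reflexive     = λ x≈y → sym (Std.reflexive x≈y)
        ; trans         = λ x≤y y≤z → sym (Std.trans (sym x≤y) (sym y≤z))
        }
      ; antisym = λ x≤y y≤x → Std.antisym (sym x≤y) (sym y≤x)
      }
    ; supremum = λ x y → sym (Std.x≤x∨y x y) , sym (Std.y≤x∨y x y) ,
                         λ z x≤z y≤z → sym (Std.∨-least (sym x≤z) (sym y≤z))
    ; infimum  = λ x y → sym (Std.x∧y≤x x y) , sym (Std.x∧y≤y x y) ,
                         λ z z≤x z≤y → sym (Std.∧-greatest (sym z≤x) (sym z≤y))
    }

  open Order.IsLattice ≤-isLattice public

  poset : Poset c ℓ ℓ
  poset = record { isPartialOrder = isPartialOrder }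

  ·-monoˡ-≤ : ∀ {x y} z → x ≤ y → x · z ≤ y · z
  ·-monoˡ-≤ z x≤y = resʳ-to (trans x≤y (resʳ-from refl))

  ·-monoʳ-≤ : ∀ {x y} z → x ≤ y → z · x ≤ z · y
  ·-monoʳ-≤ z x≤y = resˡ-to (trans x≤y (resˡ-from refl))

module SubwordUpSets {a} (A : Set a) (p : Level) where

  record UpSet : Set (suc (a ⊔ p)) where
    field
      Member    : List A → Set (a ⊔ p)
      upClosed  : ∀ {u v} → u ⊆ v → Member u → Member v
      inhabited : ∃ Member

  open UpSet public

  infix 4 _∈_ _⊆ᵘ_ _≃_ _≤ᵘ_
  infixr 6 _∪_
  infixr 7 _∩_
  infixl 8 _∙_

  _∈_ : List A → UpSet → Set (a ⊔ p)
  w ∈ X = Member X w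

  _⊆ᵘ_ : UpSet → UpSet → Set (a ⊔ p)
  X ⊆ᵘ Y = ∀ w → w ∈ X → w ∈ Y

  -- Declared one universe up, so that the equality lives at the level of the carrier.
  record _≃_ (X Y : UpSet) : Set (suc (a ⊔ p)) where
    constructor ⊆ᵘ-antisym
    field
      ≃⇒⊆ᵘ : X ⊆ᵘ Y
      ≃⇒⊇ᵘ : Y ⊆ᵘ X

  ≃-isEquivalence : IsEquivalence _≃_
  ≃-isEquivalence = record
    { refl  = ⊆ᵘ-antisym (λ _ w∈X → w∈X) (λ _ w∈X → w∈X)
    ; sym   = λ (⊆ᵘ-antisym X⊆Y Y⊆X) → ⊆ᵘ-antisym Y⊆X X⊆Y
    ; trans = λ (⊆ᵘ-antisym X⊆Y Y⊆X) (⊆ᵘ-antisym Y⊆Z Z⊆Y) →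
                ⊆ᵘ-antisym (λ w → Y⊆Z w ∘ X⊆Y w) (λ w → Y⊆X w ∘ Z⊆Y w)
    }

  _∩_ : UpSet → UpSet → UpSet
  X ∩ Y = record
    { Member    = λ w → w ∈ X × w ∈ Y
    ; upClosed  = λ u⊆v (u∈X , u∈Y) → upClosed X u⊆v u∈X , upClosed Y u⊆v u∈Y
    ; inhabited = let x , x∈X = inhabited X ; y , y∈Y = inhabited Y in
                  x ++ y , upClosed X (++⁺ʳ y ⊆-refl) x∈X , upClosed Y (++⁺ˡ x ⊆-refl) y∈Y
    }

  _∪_ : UpSet → UpSet → UpSet
  X ∪ Y = record
    { Member    = λ w → w ∈ X ⊎ w ∈ Y
    ; upClosed  = λ u⊆v → Sum.map (upClosed X u⊆v) (upClosed Y u⊆v)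
    ; inhabited = let x , x∈X = inhabited X in x , inj₁ x∈X
    }

  _∙_ : UpSet → UpSet → UpSet
  X ∙ Y = record
    { Member    = λ w → ∃ λ x → ∃ λ y → x ∈ X × y ∈ Y × x ++ y ⊆ w
    ; upClosed  = λ u⊆v (x , y , x∈X , y∈Y , xy⊆u) → x , y , x∈X , y∈Y , ⊆-trans xy⊆u u⊆v
    ; inhabited = let x , x∈X = inhabited X ; y , y∈Y = inhabited Y in
                  x ++ y , x , y , x∈X , y∈Y , ⊆-refl
    }

  Words : UpSet
  Words = record { Member = λ _ → ⊤ ; upClosed = λ _ _ → _ ; inhabited = [] , _ }

  _\\ᵘ_ : UpSet → UpSet → UpSet
  X \\ᵘ Z = record
    { Member    = λ w → ∀ x → x ∈ X → x ++ w ∈ Z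
    ; upClosed  = λ u⊆v h x x∈X → upClosed Z (++⁺ ⊆-refl u⊆v) (h x x∈X)
    ; inhabited = let z , z∈Z = inhabited Z in z , λ x _ → upClosed Z (++⁺ˡ x ⊆-refl) z∈Z
    }

  _//ᵘ_ : UpSet → UpSet → UpSet
  Z //ᵘ Y = record
    { Member    = λ w → ∀ y → y ∈ Y → w ++ y ∈ Z
    ; upClosed  = λ u⊆v h y y∈Y → upClosed Z (++⁺ u⊆v ⊆-refl) (h y y∈Y)
    ; inhabited = let z , z∈Z = inhabited Z in z , λ y _ → upClosed Z (++⁺ʳ y ⊆-refl) z∈Z
    }

  ≃-isLattice : IsLattice _≃_ _∪_ _∩_
  ≃-isLattice = record
    { isEquivalence = ≃-isEquivalence
    ; ∨-comm        = λ _ _ → ⊆ᵘ-antisym (λ _ → Sum.swap) (λ _ → Sum.swap)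
    ; ∨-assoc       = λ _ _ _ → ⊆ᵘ-antisym (λ _ → Sum.assocʳ) (λ _ → Sum.assocˡ)
    ; ∨-cong        = λ (⊆ᵘ-antisym X⊆X′ X′⊆X) (⊆ᵘ-antisym Y⊆Y′ Y′⊆Y) →
                        ⊆ᵘ-antisym (λ w → Sum.map (X⊆X′ w) (Y⊆Y′ w))
                                   (λ w → Sum.map (X′⊆X w) (Y′⊆Y w))
    ; ∧-comm        = λ _ _ → ⊆ᵘ-antisym (λ _ → Product.swap) (λ _ → Product.swap)
    ; ∧-assoc       = λ _ _ _ → ⊆ᵘ-antisym (λ _ → Product.assocʳ′) (λ _ → Product.assocˡ′)
    ; ∧-cong        = λ (⊆ᵘ-antisym X⊆X′ X′⊆X) (⊆ᵘ-antisym Y⊆Y′ Y′⊆Y) →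
                        ⊆ᵘ-antisym (λ w → Product.map (X⊆X′ w) (Y⊆Y′ w))
                                   (λ w → Product.map (X′⊆X w) (Y′⊆Y w))
    ; absorptive    = (λ _ _ → ⊆ᵘ-antisym (λ _ → [ id , proj₁ ]′) (λ _ → inj₁))
                    , (λ _ _ → ⊆ᵘ-antisym (λ _ → proj₁) (λ _ w∈X → w∈X , inj₁ w∈X))
    }

  ∙-isMonoid : IsMonoid _≃_ _∙_ Words
  ∙-isMonoid = record
    { isSemigroup = record
      { isMagma = record
        { isEquivalence = ≃-isEquivalence
        ; ∙-cong        = λ (⊆ᵘ-antisym X⊆X′ X′⊆X) (⊆ᵘ-antisym Y⊆Y′ Y′⊆Y) →
            ⊆ᵘ-antisym
            (λ _ (x , y , x∈X , y∈Y , xy⊆w) → x , y , X⊆X′ x x∈X , Y⊆Y′ y y∈Y , xy⊆w)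
            (λ _ (x , y , x∈X , y∈Y , xy⊆w) → x , y , X′⊆X x x∈X , Y′⊆Y y y∈Y , xy⊆w)
        }
      ; assoc = λ _ _ _ → ⊆ᵘ-antisym
          (λ w (u , z , (x , y , x∈X , y∈Y , xy⊆u) , z∈Z , uz⊆w) →
             x , y ++ z , x∈X , (y , z , y∈Y , z∈Z , ⊆-refl) ,
             subst (_⊆ w) (++-assoc x y z) (⊆-trans (++⁺ xy⊆u ⊆-refl) uz⊆w))
          (λ w (x , v , x∈X , (y , z , y∈Y , z∈Z , yz⊆v) , xv⊆w) →
             x ++ y , z , (x , y , x∈X , y∈Y , ⊆-refl) , z∈Z ,
             subst (_⊆ w) (≡.sym (++-assoc x y z)) (⊆-trans (++⁺ ⊆-refl yz⊆v) xv⊆w))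
      }
    ; identity =
        (λ X → ⊆ᵘ-antisym
           (λ _ (x , y , _ , y∈X , xy⊆w) → upClosed X (⊆-trans (++⁺ˡ x ⊆-refl) xy⊆w) y∈X)
           (λ w w∈X → [] , w , _ , w∈X , ⊆-refl))
      , (λ X → ⊆ᵘ-antisym
           (λ _ (x , y , x∈X , _ , xy⊆w) → upClosed X (⊆-trans (++⁺ʳ y ⊆-refl) xy⊆w) x∈X)
           (λ w w∈X → w , [] , w∈X , _ , ⊆-reflexive (++-identityʳ w)))
    }

  _≤ᵘ_ : UpSet → UpSet → Set (suc (a ⊔ p))
  X ≤ᵘ Y = X ∩ Y ≃ X

  ⊆ᵘ⇒≤ᵘ : ∀ {X Y} → X ⊆ᵘ Y → X ≤ᵘ Y
  ⊆ᵘ⇒≤ᵘ X⊆Y = ⊆ᵘ-antisym (λ _ → proj₁) (λ w w∈X → w∈X , X⊆Y w w∈X)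

  ≤ᵘ⇒⊆ᵘ : ∀ {X Y} → X ≤ᵘ Y → X ⊆ᵘ Y
  ≤ᵘ⇒⊆ᵘ (⊆ᵘ-antisym _ X⊆X∩Y) w w∈X = proj₂ (X⊆X∩Y w w∈X)

  residuatedLattice : ResiduatedLattice (suc (a ⊔ p)) (suc (a ⊔ p))
  residuatedLattice = record
    { Carrier   = UpSet
    ; _≈_       = _≃_
    ; _∧_       = _∩_
    ; _∨_       = _∪_
    ; _·_       = _∙_
    ; one       = Words
    ; _\\_      = _\\ᵘ_
    ; _//_      = _//ᵘ_
    ; isLattice = ≃-isLattice
    ; isMonoid  = ∙-isMonoid
    ; resˡ-to   = λ {_} {_} {Z} Y≤X\Z → ⊆ᵘ⇒≤ᵘ λ w (x , y , x∈X , y∈Y , xy⊆w) →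
                    upClosed Z xy⊆w (≤ᵘ⇒⊆ᵘ Y≤X\Z y y∈Y x x∈X)
    ; resˡ-from = λ XY≤Z → ⊆ᵘ⇒≤ᵘ λ w w∈Y x x∈X →
                    ≤ᵘ⇒⊆ᵘ XY≤Z (x ++ w) (x , w , x∈X , w∈Y , ⊆-refl)
    ; resʳ-to   = λ {_} {_} {Z} X≤Z/Y → ⊆ᵘ⇒≤ᵘ λ w (x , y , x∈X , y∈Y , xy⊆w) →
                    upClosed Z xy⊆w (≤ᵘ⇒⊆ᵘ X≤Z/Y x x∈X y y∈Y)
    ; resʳ-from = λ XY≤Z → ⊆ᵘ⇒≤ᵘ λ w w∈X y y∈Y →
                    ≤ᵘ⇒⊆ᵘ XY≤Z (w ++ y) (w , y , w∈X , y∈Y , ⊆-refl)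
    }

  isIntegral : IsIntegral residuatedLattice
  isIntegral _ = ⊆ᵘ⇒≤ᵘ λ _ _ → _

  isDistributive : IsDistributive residuatedLattice
  isDistributive _ _ _ = ⊆ᵘ-antisym
    (λ _ (w∈X , w∈Y∪Z) → Sum.map (w∈X ,_) (w∈X ,_) w∈Y∪Z)
    (λ _ → [ Product.map₂ inj₁ , Product.map₂ inj₂ ]′)

  witness-descent : ∀ {q} {P : Set q} Z →
                    (∀ {z} → z ∈ Z → P ⊎ ∃ λ z′ → z′ ∈ Z × length z′ ℕ.< length z) → P
  witness-descent {P = P} Z step = descend (proj₂ (inhabited Z)) (<-wellFounded _)
    where
    descend : ∀ {z} → z ∈ Z → Acc ℕ._<_ (length z) → P
    descend z∈Z (acc smaller) with step z∈Z
    ... | inj₁ done               = done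
    ... | inj₂ (_ , z′∈Z , z′<z) = descend z′∈Z (smaller z′<z)

  ∙-cancelʳ : ∀ X Y Z → X ∙ Z ⊆ᵘ Y ∙ Z → X ⊆ᵘ Y
  ∙-cancelʳ X Y Z XZ⊆YZ w w∈X = witness-descent Z λ {z} z∈Z →
    let y , z′ , y∈Y , z′∈Z , yz′⊆wz = XZ⊆YZ (w ++ z) (w , z , w∈X , z∈Z , ⊆-refl) in
    Sum.map (λ y⊆w → upClosed Y y⊆w y∈Y) (λ z′<z → z′ , z′∈Z , z′<z)
            (++-⊆-++-cancelʳ⊎shorter w yz′⊆wz)

  ∙-cancelˡ : ∀ X Y Z → Z ∙ X ⊆ᵘ Z ∙ Y → X ⊆ᵘ Y
  ∙-cancelˡ X Y Z ZX⊆ZY w w∈X = witness-descent Z λ {z} z∈Z →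
    let z′ , y , z′∈Z , y∈Y , z′y⊆zw = ZX⊆ZY (z ++ w) (z , w , z∈Z , w∈X , ⊆-refl) in
    Sum.map (λ y⊆w → upClosed Y y⊆w y∈Y) (λ z′<z → z′ , z′∈Z , z′<z)
            (++-⊆-++-cancelˡ⊎shorter w z′y⊆zw)

  isCancellative : IsCancellative residuatedLattice
  isCancellative =
    (λ {X} {Y} {Z} XZ≤YZ → ⊆ᵘ⇒≤ᵘ (∙-cancelʳ X Y Z (≤ᵘ⇒⊆ᵘ XZ≤YZ))) ,
    (λ {X} {Y} {Z} ZX≤ZY → ⊆ᵘ⇒≤ᵘ (∙-cancelˡ X Y Z (≤ᵘ⇒⊆ᵘ ZX≤ZY)))

  ∙-distribˡ-∩ : ∀ X Y Z → X ∙ Y ∩ X ∙ Z ⊆ᵘ X ∙ (Y ∩ Z)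
  ∙-distribˡ-∩ X Y Z w ((x₁ , y , x₁∈X , y∈Y , x₁y⊆w) , (x₂ , z , x₂∈X , z∈Z , x₂z⊆w))
    with ++-⊆-split x₁ x₁y⊆w | ++-⊆-split x₂ x₂z⊆w
  ... | n₁ , x₁⊆w₁ , y⊆w₁′ | n₂ , x₂⊆w₂ , z⊆w₂′ with ≤-total n₁ n₂
  ... | inj₁ n₁≤n₂ = x₁ , drop n₁ w , x₁∈X ,
          (upClosed Y y⊆w₁′ y∈Y , upClosed Z (⊆-trans z⊆w₂′ (drop⁺-≥ n₁≤n₂)) z∈Z) ,
          take++drop-⊆ n₁ x₁⊆w₁ ⊆-refl
  ... | inj₂ n₂≤n₁ = x₂ , drop n₂ w , x₂∈X ,
          (upClosed Y (⊆-trans y⊆w₁′ (drop⁺-≥ n₂≤n₁)) y∈Y , upClosed Z z⊆w₂′ z∈Z) ,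
          take++drop-⊆ n₂ x₂⊆w₂ ⊆-refl

  ∙-distribʳ-∩ : ∀ X Y Z → X ∙ Z ∩ Y ∙ Z ⊆ᵘ (X ∩ Y) ∙ Z
  ∙-distribʳ-∩ X Y Z w ((x , z₁ , x∈X , z₁∈Z , xz₁⊆w) , (y , z₂ , y∈Y , z₂∈Z , yz₂⊆w))
    with ++-⊆-split x xz₁⊆w | ++-⊆-split y yz₂⊆w
  ... | n₁ , x⊆w₁ , z₁⊆w₁′ | n₂ , y⊆w₂ , z₂⊆w₂′ with ≤-total n₁ n₂
  ... | inj₁ n₁≤n₂ = take n₂ w , z₂ ,
          (upClosed X (⊆-trans x⊆w₁ (take⁺ n₁≤n₂)) x∈X , upClosed Y y⊆w₂ y∈Y) , z₂∈Z ,
          take++drop-⊆ n₂ ⊆-refl z₂⊆w₂′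
  ... | inj₂ n₂≤n₁ = take n₁ w , z₁ ,
          (upClosed X x⊆w₁ x∈X , upClosed Y (⊆-trans y⊆w₂ (take⁺ n₂≤n₁)) y∈Y) , z₁∈Z ,
          take++drop-⊆ n₁ ⊆-refl z₁⊆w₁′

  multDistribOverMeet : MultDistribOverMeet residuatedLattice
  multDistribOverMeet =
    (λ X Y Z → ⊆ᵘ-antisym
      (λ _ (x , v , x∈X , (v∈Y , v∈Z) , xv⊆w) →
        (x , v , x∈X , v∈Y , xv⊆w) , (x , v , x∈X , v∈Z , xv⊆w))
      (∙-distribˡ-∩ X Y Z)) ,
    (λ X Y Z → ⊆ᵘ-antisym
      (λ _ (v , z , (v∈X , v∈Y) , z∈Z , vz⊆w) →
        (v , z , v∈X , z∈Z , vz⊆w) , (v , z , v∈Y , z∈Z , vz⊆w))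
      (∙-distribʳ-∩ X Y Z))

module WordClosure {c ℓ} (L : ResiduatedLattice c ℓ) (integral : IsIntegral L) where
  open ResiduatedLattice L
  open ResiduatedLatticeOrder L
  open SubwordUpSets Carrier ℓ
  open ≤-Reasoning poset
  private module Monoid = IsMonoid isMonoid

  ∏ : List Carrier → Carrier
  ∏ = foldr _·_ one

  ∏-++ : ∀ u v → ∏ (u ++ v) ≈ ∏ u · ∏ v
  ∏-++ []      v = Eq.sym (Monoid.identityˡ (∏ v))
  ∏-++ (x ∷ u) v = Eq.trans (Monoid.∙-cong Eq.refl (∏-++ u v)) (Eq.sym (Monoid.assoc x (∏ u) (∏ v)))

  ∏-[_] : ∀ a → ∏ [ a ] ≈ a
  ∏-[ a ] = Monoid.identityʳ a

  ∏-antitone : ∀ {u v} → u ⊆ v → ∏ v ≤ ∏ u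
  ∏-antitone [] = refl
  ∏-antitone (_∷ʳ_ {xs = u} {ys = v} y u⊆v) = begin
    y · ∏ v    ≤⟨ ·-monoˡ-≤ (∏ v) (integral y) ⟩
    one · ∏ v  ≈⟨ Monoid.identityˡ (∏ v) ⟩
    ∏ v        ≤⟨ ∏-antitone u⊆v ⟩
    ∏ u        ∎
  ∏-antitone (≡.refl ∷ u⊆v) = ·-monoʳ-≤ _ (∏-antitone u⊆v)

  ∏-++-≤ : ∀ u v {a b} → ∏ u ≤ a → ∏ v ≤ b → ∏ (u ++ v) ≤ a · b
  ∏-++-≤ u v {a} {b} u≤a v≤b = begin
    ∏ (u ++ v)  ≈⟨ ∏-++ u v ⟩
    ∏ u · ∏ v   ≤⟨ ·-monoˡ-≤ (∏ v) u≤a ⟩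
    a · ∏ v     ≤⟨ ·-monoʳ-≤ a v≤b ⟩
    a · b       ∎

  UpperBound : UpSet → Carrier → Set (c ⊔ ℓ)
  UpperBound X u = ∀ v → v ∈ X → ∏ v ≤ u

  closure : UpSet → UpSet
  closure X = record
    { Member    = λ w → ∀ u → UpperBound X u → ∏ w ≤ u
    ; upClosed  = λ v⊆w v∈γX u X≤u → trans (∏-antitone v⊆w) (v∈γX u X≤u)
    ; inhabited = let x , x∈X = inhabited X in x , λ u X≤u → X≤u x x∈X
    }

  UpperBound-∙ˡ : ∀ {X Y u v} → UpperBound (X ∙ Y) u → v ∈ X → UpperBound Y (∏ v \\ u)
  UpperBound-∙ˡ {v = v} XY≤u v∈X y y∈Y =
    resˡ-from (≤-respˡ-≈ (∏-++ v y) (XY≤u (v ++ y) (v , y , v∈X , y∈Y , ⊆-refl)))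

  UpperBound-∙ʳ : ∀ {X Y u y} → UpperBound (X ∙ Y) u → y ∈ closure Y → UpperBound X (u // ∏ y)
  UpperBound-∙ʳ {X} {Y} {u} XY≤u y∈γY v v∈X =
    resʳ-from (resˡ-to (y∈γY (∏ v \\ u) (UpperBound-∙ˡ {X} {Y} {v = v} XY≤u v∈X)))

  closure-∙ : ∀ X Y → closure X ∙ closure Y ⊆ᵘ closure (X ∙ Y)
  closure-∙ X Y w (x , y , x∈γX , y∈γY , xy⊆w) u XY≤u = begin
    ∏ w            ≤⟨ ∏-antitone xy⊆w ⟩
    ∏ (x ++ y)     ≤⟨ ∏-++-≤ x y x≤u/y refl ⟩
    u // ∏ y · ∏ y ≤⟨ resʳ-to refl ⟩
    u              ∎
    where
    x≤u/y : ∏ x ≤ u // ∏ y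
    x≤u/y = x∈γX (u // ∏ y) (UpperBound-∙ʳ {X} {Y} {y = y} XY≤u y∈γY)

  closure-isNucleus : IsNucleus residuatedLattice closure
  closure-isNucleus = record
    { cong       = λ (⊆ᵘ-antisym X⊆Y Y⊆X) → ⊆ᵘ-antisym
                     (λ w w∈γX u Y≤u → w∈γX u (λ v v∈X → Y≤u v (X⊆Y v v∈X)))
                     (λ w w∈γY u X≤u → w∈γY u (λ v v∈Y → X≤u v (Y⊆X v v∈Y)))
    ; monotone   = λ X≤Y → ⊆ᵘ⇒≤ᵘ λ w w∈γX u Y≤u →
                     w∈γX u (λ v v∈X → Y≤u v (≤ᵘ⇒⊆ᵘ X≤Y v v∈X))
    ; extensive  = λ X → ⊆ᵘ⇒≤ᵘ λ w w∈X u X≤u → X≤u w w∈X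
    ; idempotent = λ X → ⊆ᵘ-antisym
                     (λ w w∈γγX u X≤u → w∈γγX u (λ v v∈γX → v∈γX u X≤u))
                     (λ w w∈γX u γX≤u → γX≤u w w∈γX)
    ; mult       = λ X Y → ⊆ᵘ⇒≤ᵘ (closure-∙ X Y)
    }

  principal : Carrier → UpSet
  principal a = record
    { Member    = λ w → Lift c (∏ w ≤ a)
    ; upClosed  = λ v⊆w (lift v≤a) → lift (trans (∏-antitone v⊆w) v≤a)
    ; inhabited = [ a ] , lift (reflexive ∏-[ a ])
    }

  [_]∈principal : ∀ a → [ a ] ∈ principal a
  [ a ]∈principal = lift (reflexive ∏-[ a ])

  principal-mono : ∀ {a b} → a ≤ b → principal a ⊆ᵘ principal b
  principal-mono a≤b _ (lift w≤a) = lift (trans w≤a a≤b)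

  principal-reflects : ∀ {a b} → principal a ⊆ᵘ principal b → a ≤ b
  principal-reflects {a} a⊆b = ≤-respˡ-≈ ∏-[ a ] (lower (a⊆b [ a ] [ a ]∈principal))

  principal-upperBound : ∀ a → UpperBound (principal a) a
  principal-upperBound _ _ = lower

  principal-closed : ∀ a → closure (principal a) ≃ principal a
  principal-closed a = ⊆ᵘ-antisym (λ w w∈γa → lift (w∈γa a (principal-upperBound a)))
                                  (λ w w∈a u a≤u → a≤u w w∈a)

  principal-∨ : ∀ a b → principal (a ∨ b) ≃ closure (principal a ∪ principal b)
  principal-∨ a b = ⊆ᵘ-antisym
    (λ w (lift w≤a∨b) u ab≤u → trans w≤a∨b (∨-least
      (principal-reflects λ v v∈a → lift (ab≤u v (inj₁ v∈a)))
      (principal-reflects λ v v∈b → lift (ab≤u v (inj₂ v∈b)))))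
    (λ w w∈γab → lift (w∈γab (a ∨ b) λ _ →
      [ (λ (lift v≤a) → trans v≤a (x≤x∨y a b)) , (λ (lift v≤b) → trans v≤b (y≤x∨y a b)) ]′))

  principal-∧ : ∀ a b → principal (a ∧ b) ≃ principal a ∩ principal b
  principal-∧ a b = ⊆ᵘ-antisym
    (λ _ (lift w≤a∧b) → lift (trans w≤a∧b (x∧y≤x a b)) , lift (trans w≤a∧b (x∧y≤y a b)))
    (λ _ (lift w≤a , lift w≤b) → lift (∧-greatest w≤a w≤b))

  principal-· : ∀ a b → principal (a · b) ≃ closure (principal a ∙ principal b)
  principal-· a b = ⊆ᵘ-antisym
    (λ w (lift w≤ab) u ab≤u → begin
      ∏ w                  ≤⟨ w≤ab ⟩
      a · b                ≈⟨ Monoid.∙-cong ∏-[ a ] ∏-[ b ] ⟨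
      ∏ [ a ] · ∏ [ b ]    ≈⟨ ∏-++ [ a ] [ b ] ⟨
      ∏ ([ a ] ++ [ b ])   ≤⟨ ab≤u _ ([ a ] , [ b ] , [ a ]∈principal , [ b ]∈principal , ⊆-refl) ⟩
      u                    ∎)
    (λ w w∈γab → lift (w∈γab (a · b) λ v (x , y , lift x≤a , lift y≤b , xy⊆v) →
      trans (∏-antitone xy⊆v) (∏-++-≤ x y x≤a y≤b)))

  principal-one : principal one ≃ closure Words
  principal-one = ⊆ᵘ-antisym (λ w _ u Words≤u → Words≤u w _) (λ w _ → lift (integral (∏ w)))

  principal-\\ : ∀ a b → principal (a \\ b) ≃ principal a \\ᵘ principal b
  principal-\\ a b = ⊆ᵘ-antisym
    (λ w (lift w≤a\b) x (lift x≤a) → lift (trans (∏-++-≤ x w x≤a w≤a\b) (resˡ-to refl)))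
    (λ w w∈a\b → lift (resˡ-from (lower (w∈a\b [ a ] [ a ]∈principal))))

  principal-// : ∀ a b → principal (a // b) ≃ principal a //ᵘ principal b
  principal-// a b = ⊆ᵘ-antisym
    (λ w (lift w≤a/b) y (lift y≤b) → lift (trans (∏-++-≤ w y w≤a/b y≤b) (resʳ-to refl)))
    (λ w w∈a/b → lift (resʳ-from (≤-respˡ-≈
      (Eq.trans (∏-++ w [ b ]) (Monoid.∙-cong Eq.refl ∏-[ b ]))
      (lower (w∈a/b [ b ] [ b ]∈principal)))))

  principal-isEmbedding : IsEmbeddingIntoNuclearImage L residuatedLattice closure principal
  principal-isEmbedding = record
    { cong      = λ a≈b → ⊆ᵘ-antisym (principal-mono (reflexive a≈b))
                                     (principal-mono (reflexive (Eq.sym a≈b)))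
    ; injective = λ (⊆ᵘ-antisym a⊆b b⊆a) → antisym (principal-reflects a⊆b) (principal-reflects b⊆a)
    ; closed    = principal-closed
    ; pres-∧    = principal-∧
    ; pres-∨    = principal-∨
    ; pres-·    = principal-·
    ; pres-one  = principal-one
    ; pres-\\   = principal-\\
    ; pres-//   = principal-//
    }

mainTheorem19 : {c ℓ : Level} (L : ResiduatedLattice c ℓ) → IsIntegral L →
    Σ (ResiduatedLattice (suc (c ⊔ ℓ)) (suc (c ⊔ ℓ))) λ M →
    IsDistributive M × IsIntegral M × IsCancellative M × MultDistribOverMeet M ×
    Σ (ResiduatedLattice.Carrier M → ResiduatedLattice.Carrier M) λ γ →
    IsNucleus M γ ×
    Σ (ResiduatedLattice.Carrier L → ResiduatedLattice.Carrier M) λ f →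
    IsEmbeddingIntoNuclearImage L M γ f
mainTheorem19 {ℓ = ℓ} L integral =
  residuatedLattice , isDistributive , isIntegral , isCancellative , multDistribOverMeet ,
  closure , closure-isNucleus , principal , principal-isEmbedding
  where
  open SubwordUpSets (ResiduatedLattice.Carrier L) ℓ
  open WordClosure L integral
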